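{- For every integer $n>0$, the number of firing moves in the endgame, i.e. the number of elements of the poset $P_n$, equals $2^n-(n+1)$.
   Context: Setting: the infinite binary tree with nodes labeled by positive integers (root $1$; node $i$ has left child $2i$, right child $2i+1$, parent $\lfloor i/2\rfloor$ for $i>1$), with a self-loop at the root; $\mathrm{level}(i)=\lfloor\log_2 i\rfloor+1$. Labeled chip-firing: a node holding at least $3$ chips may fire any $3$ of them, sending the smallest to its left child, the largest to its right child and the middle one to its parent (the root keeps it). Start with $2^n-1$ chips labeled $1,\dots,2^n-1$ at the root; a complete firing sequence is a finite sequence of legal firings ending in a configuration where no node holds $3$ or more chips. In every complete firing sequence each node fires the same number of times; $(i,j)$ denotes the $(j+1)$-th-to-last firing of node $i$ ($j\ge0$). The endgame moves are the moves $(i,j)$ with $\mathrm{level}(i)+j<n$; $P_n$ is the set of endgame moves. -}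

module Defs where

open import Data.Nat using (ℕ; zero; suc; _+_; _*_; _∸_; _^_; _≤_; _<_; ⌊_/2⌋)
open import Data.Nat.Properties using (_≟_)
open import Data.Nat.Logarithm using (⌊log₂_⌋)
open import Data.List using (List; []; _∷_; length; filter; map; upTo)
open import Data.List.Relation.Binary.Permutation.Propositional using (_↭_)
open import Data.Product using (Σ; _×_; _,_)
open import Relation.Nullary using (yes; no)

level : ℕ → ℕ
level i = ⌊log₂ i ⌋ + 1

-- A configuration assigns to each node (positive integer; node 0 unused)
-- the list of labels of the chips it holds.
Config : Set
Config = ℕ → List ℕ

initial : ℕ → Config
initial n j with j ≟ 1
... | yes _ = map suc (upTo (2 ^ n ∸ 1))
... | no _  = []

-- Result of node i (i ≥ 1) firing chips a < b < c, where the chips at i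
-- are (a permutation of) a ∷ b ∷ c ∷ rest: a to the left child 2i,
-- c to the right child 2i+1, b to the parent ⌊i/2⌋ (kept if i = 1).
fire : Config → ℕ → ℕ → ℕ → ℕ → List ℕ → Config
fire C i a b c rest j with j ≟ i
... | yes _ with i ≟ 1
...   | yes _ = b ∷ rest
...   | no _  = rest
fire C i a b c rest j | no _ with j ≟ 2 * i
... | yes _ = a ∷ C j
... | no _ with j ≟ 2 * i + 1
...   | yes _ = c ∷ C j
...   | no _ with i ≟ 1
...     | yes _ = C j
...     | no _ with j ≟ ⌊ i /2⌋
...       | yes _ = b ∷ C j
...       | no _  = C j

data Run : Config → List ℕ → Config → Set where
  done : ∀ {C} → Run C [] C
  step : ∀ {C C'' is} (i a b c : ℕ) (rest : List ℕ) →
         1 ≤ i → a < b → b < c → C i ↭ (a ∷ b ∷ c ∷ rest) →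
         Run (fire C i a b c rest) is C'' → Run C (i ∷ is) C''

Terminal : Config → Set
Terminal C = ∀ j → length (C j) < 3

Complete : ℕ → List ℕ → Set
Complete n is = Σ Config (λ C → Run (initial n) is C × Terminal C)

fires : List ℕ → ℕ → ℕ
fires is i = length (filter (_≟ i) is)

-- Endgame moves (i , j): node i ≥ 1 has a (j+1)-th-to-last firing
-- (j < number of firings of i) and level(i) + j < n.
EndgameMove : ℕ → List ℕ → ℕ × ℕ → Set
EndgameMove n is (i , j) = (1 ≤ i) × (j < fires is i) × (level i + j < n)

-- Every complete firing sequence fires each node of level ℓ at least n − ℓ times. Consider the
-- level-symmetric process, in which all nodes of a level fire together. It has a legal schedule in
-- which level ℓ fires at least n − ℓ times: for p = 1, …, n − 1 repeat 2^(n−p) − 1 times the sweep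
-- "fire levels p, p − 1, …, 1". Conversely, by a least-action argument, no legal symmetric schedule
-- lets a level fire more often than one of its nodes fires in a stabilising sequence: at the first
-- firing that would, the chip balance of that node leaves it with at least three chips at the end.
-- Hence (i , j) is an endgame move exactly when level(i) + j < n, and there are
-- Σ_{ℓ<n} 2^(ℓ−1) (n − ℓ) = 2^n − n − 1 such pairs.
module Submission where

open import Defs
open import Data.Nat using (ℕ; zero; suc; pred; _+_; _*_; _∸_; _^_; _≤_; _<_; z≤n; s≤s; s≤s⁻¹; ⌊_/2⌋)
open import Data.Nat.Properties
open import Data.Nat.Logarithm using (⌊log₂_⌋; ⌊log₂⌋-mono-≤; ⌊log₂⌊n/2⌋⌋≡⌊log₂n⌋∸1; ⌊log₂[2*b]⌋≡1+⌊log₂b⌋)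
open import Data.Nat.Tactic.RingSolver using (solve-∀)
open import Data.Fin using (Fin; toℕ; fromℕ<)
open import Data.Fin.Properties using (toℕ<n; fromℕ<-toℕ; toℕ-fromℕ<; +↔⊎)
open import Data.List using (List; []; _∷_; [_]; length; upTo)
open import Data.List.Properties using (length-map; length-upTo; filter-accept; filter-reject)
open import Data.List.Relation.Binary.Permutation.Propositional.Properties using (↭-length)
open import Data.Sum using (_⊎_; inj₁; inj₂)
open import Data.Sum.Function.Propositional using (_⊎-↔_)
open import Data.Product using (Σ; _×_; _,_)
open import Data.Empty using (⊥-elim)
open import Function using (_∘_; _$_)
open import Function.Bundles using (_↔_; mk↔ₛ′)
open import Function.Properties.Inverse using (↔-trans; ↔-sym)
open import Relation.Binary.PropositionalEquality hiding ([_])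
open import Relation.Binary.Construct.Closure.ReflexiveTransitive using (Star; ε; _◅_; _◅◅_)
open import Relation.Nullary using (yes; no)

⌊2*n/2⌋≡n : ∀ n → ⌊ 2 * n /2⌋ ≡ n
⌊2*n/2⌋≡n n = sym (trans (n≡⌊n+n/2⌋ n) (cong (λ m → ⌊ n + m /2⌋) (sym (+-identityʳ n))))

⌊2*n+1/2⌋≡n : ∀ n → ⌊ 2 * n + 1 /2⌋ ≡ n
⌊2*n+1/2⌋≡n zero    = refl
⌊2*n+1/2⌋≡n (suc n) = trans (cong (λ m → ⌊ m + 1 /2⌋) (*-suc 2 n)) (cong suc (⌊2*n+1/2⌋≡n n))

parity : ∀ n → n ≡ 2 * ⌊ n /2⌋ ⊎ n ≡ 2 * ⌊ n /2⌋ + 1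
parity zero          = inj₁ refl
parity (suc zero)    = inj₂ refl
parity (suc (suc n)) with parity n
... | inj₁ e = inj₁ (trans (cong (2 +_) e) (sym (*-suc 2 ⌊ n /2⌋)))
... | inj₂ e = inj₂ (trans (cong (2 +_) e) (sym (cong (_+ 1) (*-suc 2 ⌊ n /2⌋))))

n≤2*⌊n/2⌋+1 : ∀ n → n ≤ 2 * ⌊ n /2⌋ + 1
n≤2*⌊n/2⌋+1 n with parity n
... | inj₁ e = ≤-trans (≤-reflexive e) (m≤m+n _ 1)
... | inj₂ e = ≤-reflexive e

n<2*n : ∀ {n} → 1 ≤ n → n < 2 * n
n<2*n {n} 1≤n = m<m+n n (≤-trans 1≤n (m≤m+n n 0))

n<2*n+1 : ∀ n → n < 2 * n + 1
n<2*n+1 n = subst (suc n ≤_) (+-comm 1 (2 * n)) (s≤s (m≤n*m n 2))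

level-suc : ∀ v → level v ≡ suc ⌊log₂ v ⌋
level-suc v = +-comm ⌊log₂ v ⌋ 1

1≤level : ∀ v → 1 ≤ level v
1≤level v = subst (1 ≤_) (sym (level-suc v)) (s≤s z≤n)

level-parent : ∀ v → 2 ≤ v → level v ≡ suc (level ⌊ v /2⌋)
level-parent v 2≤v = begin
  level v                   ≡⟨ level-suc v ⟩
  suc ⌊log₂ v ⌋             ≡⟨ cong suc (sym (m∸n+n≡m (⌊log₂⌋-mono-≤ 2≤v))) ⟩
  suc (⌊log₂ v ⌋ ∸ 1 + 1)   ≡⟨ cong (λ m → suc (m + 1)) (sym (⌊log₂⌊n/2⌋⌋≡⌊log₂n⌋∸1 v)) ⟩
  suc (level ⌊ v /2⌋)       ∎
  where open ≡-Reasoning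

level-double : ∀ v → 1 ≤ v → level (2 * v) ≡ suc (level v)
level-double (suc v) _ = cong (_+ 1) (⌊log₂[2*b]⌋≡1+⌊log₂b⌋ (suc v))

level-double+1 : ∀ v → 1 ≤ v → level (2 * v + 1) ≡ suc (level v)
level-double+1 v 1≤v =
  trans (level-parent (2 * v + 1) (≤-trans (*-monoʳ-≤ 2 1≤v) (m≤m+n (2 * v) 1)))
        (cong (suc ∘ level) (⌊2*n+1/2⌋≡n v))

level-≥2 : ∀ v → 2 ≤ v → 2 ≤ level v
level-≥2 v 2≤v = subst (2 ≤_) (sym (level-parent v 2≤v)) (s≤s (1≤level ⌊ v /2⌋))

-- A firing node sends one chip to each child and, unless it is the root, one to its parent, so it
-- loses out v chips; nonroot v is also the number of chips v receives when its parent fires.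
nonroot : ℕ → ℕ
nonroot (suc zero) = 0
nonroot _          = 1

out : ℕ → ℕ
out v = 2 + nonroot v

atRoot : ℕ → ℕ → ℕ
atRoot K (suc zero) = K
atRoot K _          = 0

nonroot-≥2 : ∀ {ℓ} → 2 ≤ ℓ → nonroot ℓ ≡ 1
nonroot-≥2 (s≤s (s≤s _)) = refl

atRoot-≥2 : ∀ K {ℓ} → 2 ≤ ℓ → atRoot K ℓ ≡ 0
atRoot-≥2 K (s≤s (s≤s _)) = refl

nonroot-level : ∀ v → 1 ≤ v → nonroot (level v) ≡ nonroot v
nonroot-level (suc zero)      _ = refl
nonroot-level v@(suc (suc _)) _ = nonroot-≥2 (level-≥2 v (s≤s (s≤s z≤n)))

atRoot-level : ∀ K v → 1 ≤ v → atRoot K (level v) ≡ atRoot K v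
atRoot-level K (suc zero)      _ = refl
atRoot-level K v@(suc (suc _)) _ = atRoot-≥2 K (level-≥2 v (s≤s (s≤s z≤n)))

mersenne : ℕ → ℕ
mersenne zero    = 0
mersenne (suc n) = 2 * mersenne n + 1

mersenne≡2^n∸1 : ∀ n → mersenne n ≡ 2 ^ n ∸ 1
mersenne≡2^n∸1 n = cong (_∸ 1) (1+mersenne≡2^n n)
  where
  double-suc : ∀ m → suc (2 * m + 1) ≡ 2 * suc m
  double-suc = solve-∀
  1+mersenne≡2^n : ∀ n → suc (mersenne n) ≡ 2 ^ n
  1+mersenne≡2^n zero    = refl
  1+mersenne≡2^n (suc n) = trans (double-suc (mersenne n)) (cong (2 *_) (1+mersenne≡2^n n))

n≤mersenne : ∀ n → n ≤ mersenne n
n≤mersenne zero    = z≤n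
n≤mersenne (suc n) =
  subst (suc n ≤_) (+-comm 1 (2 * mersenne n)) (s≤s (≤-trans (n≤mersenne n) (m≤n*m (mersenne n) 2)))

level≤⇒≤mersenne : ∀ n v → 1 ≤ v → level v ≤ n → v ≤ mersenne n
level≤⇒≤mersenne zero    v               _ lv≤0 = ⊥-elim (<⇒≱ (1≤level v) lv≤0)
level≤⇒≤mersenne (suc n) (suc zero)      _ _    = m≤n+m 1 (2 * mersenne n)
level≤⇒≤mersenne (suc n) v@(suc (suc _)) _ lv≤ = begin
  v                    ≤⟨ n≤2*⌊n/2⌋+1 v ⟩
  2 * ⌊ v /2⌋ + 1      ≤⟨ +-monoˡ-≤ 1 (*-monoʳ-≤ 2 parent≤mersenne) ⟩
  2 * mersenne n + 1   ∎
  where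
  open ≤-Reasoning
  parent≤mersenne : ⌊ v /2⌋ ≤ mersenne n
  parent≤mersenne = level≤⇒≤mersenne n ⌊ v /2⌋ (s≤s z≤n)
                      (s≤s⁻¹ (subst (_≤ suc n) (level-parent v (s≤s (s≤s z≤n))) lv≤))

≤mersenne⇒level≤ : ∀ n v → 1 ≤ v → v ≤ mersenne n → level v ≤ n
≤mersenne⇒level≤ zero    (suc v)         _ ()
≤mersenne⇒level≤ (suc n) (suc zero)      _ _  = s≤s z≤n
≤mersenne⇒level≤ (suc n) v@(suc (suc _)) _ v≤ =
  subst (_≤ suc n) (sym (level-parent v (s≤s (s≤s z≤n))))
        (s≤s (≤mersenne⇒level≤ n ⌊ v /2⌋ (s≤s z≤n) parent≤))
  where
  parent≤ : ⌊ v /2⌋ ≤ mersenne n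
  parent≤ = subst (⌊ v /2⌋ ≤_) (⌊2*n+1/2⌋≡n (mersenne n)) (⌊n/2⌋-mono v≤)

-- Chip balance of a firing sequence

inflow : (ℕ → ℕ) → ℕ → ℕ
inflow f v = nonroot v * f ⌊ v /2⌋ + (f (2 * v) + f (2 * v + 1))

inflow-≡ : ∀ f v {x y z} → f ⌊ v /2⌋ ≡ x → f (2 * v) ≡ y → f (2 * v + 1) ≡ z →
           inflow f v ≡ nonroot v * x + (y + z)
inflow-≡ f v refl refl refl = refl

inflow-+ : ∀ {f g h : ℕ → ℕ} v → (∀ x → h x ≡ f x + g x) → inflow h v ≡ inflow f v + inflow g v
inflow-+ {f} {g} {h} v h≡f+g = begin
  inflow h v
    ≡⟨ inflow-≡ h v (h≡f+g ⌊ v /2⌋) (h≡f+g (2 * v)) (h≡f+g (2 * v + 1)) ⟩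
  nonroot v * (f ⌊ v /2⌋ + g ⌊ v /2⌋) + ((f (2 * v) + g (2 * v)) + (f (2 * v + 1) + g (2 * v + 1)))
    ≡⟨ regroup (nonroot v) (f ⌊ v /2⌋) (g ⌊ v /2⌋) (f (2 * v)) (g (2 * v))
               (f (2 * v + 1)) (g (2 * v + 1)) ⟩
  inflow f v + inflow g v ∎
  where
  open ≡-Reasoning
  regroup : ∀ r a b c d e f → r * (a + b) + ((c + d) + (e + f)) ≡ (r * a + (c + e)) + (r * b + (d + f))
  regroup = solve-∀

fires-∷ : ∀ i is j → fires (i ∷ is) j ≡ fires [ i ] j + fires is j
fires-∷ i is j with i ≟ j
... | yes i≡j rewrite filter-accept (_≟ j) {xs = is} i≡j | filter-accept (_≟ j) {xs = []} i≡j = refl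
... | no  i≢j rewrite filter-reject (_≟ j) {xs = is} i≢j | filter-reject (_≟ j) {xs = []} i≢j = refl

fires-[i]-≡ : ∀ {i j} → i ≡ j → fires [ i ] j ≡ 1
fires-[i]-≡ {j = j} i≡j = cong length (filter-accept (_≟ j) {xs = []} i≡j)

fires-[i]-≢ : ∀ {i j} → i ≢ j → fires [ i ] j ≡ 0
fires-[i]-≢ {j = j} i≢j = cong length (filter-reject (_≟ j) {xs = []} i≢j)

initial-length : ∀ n v → length (initial n v) ≡ atRoot (2 ^ n ∸ 1) v
initial-length n zero          = refl
initial-length n (suc zero)    = trans (length-map suc (upTo (2 ^ n ∸ 1))) (length-upTo (2 ^ n ∸ 1))
initial-length n (suc (suc v)) = refl

inflow-apart : ∀ {i j} → j ≢ 2 * i → j ≢ 2 * i + 1 → j ≢ ⌊ i /2⌋ → inflow (fires [ i ]) j ≡ 0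
inflow-apart {i} {j} j≢2i j≢2i+1 j≢i/2 =
  trans (inflow-≡ (fires [ i ]) j (fires-[i]-≢ not-parent) (fires-[i]-≢ not-left) (fires-[i]-≢ not-right))
        (trans (+-identityʳ (nonroot j * 0)) (*-zeroʳ (nonroot j)))
  where
  not-parent : i ≢ ⌊ j /2⌋
  not-parent refl with parity j
  ... | inj₁ e = j≢2i e
  ... | inj₂ e = j≢2i+1 e
  not-left : i ≢ 2 * j
  not-left refl = j≢i/2 (sym (⌊2*n/2⌋≡n j))
  not-right : i ≢ 2 * j + 1
  not-right refl = j≢i/2 (sym (⌊2*n+1/2⌋≡n j))

inflow-self : ∀ {i} → 1 ≤ i → inflow (fires [ i ]) i ≡ 0
inflow-self {suc i} 1≤i = inflow-apart (<⇒≢ (n<2*n 1≤i)) (<⇒≢ (n<2*n+1 (suc i))) (>⇒≢ (⌊n/2⌋<n i))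

inflow-child : ∀ {i j} → 1 ≤ i → ⌊ j /2⌋ ≡ i → inflow (fires [ i ]) j ≡ 1
inflow-child {j = zero}          () refl
inflow-child {j = suc zero}      () refl
inflow-child {j = j@(suc (suc _))} _ refl =
  inflow-≡ (fires [ ⌊ j /2⌋ ]) j (fires-[i]-≡ {⌊ j /2⌋} refl)
           (fires-[i]-≢ (<⇒≢ below-left)) (fires-[i]-≢ (<⇒≢ below-right))
  where
  below-left : ⌊ j /2⌋ < 2 * j
  below-left = ≤-<-trans (⌊n/2⌋≤n j) (n<2*n (s≤s z≤n))
  below-right : ⌊ j /2⌋ < 2 * j + 1
  below-right = ≤-<-trans (⌊n/2⌋≤n j) (n<2*n+1 j)

inflow-parent : ∀ {i} → 2 ≤ i → inflow (fires [ i ]) ⌊ i /2⌋ ≡ 1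
inflow-parent {i@(suc (suc k))} (s≤s (s≤s _)) =
  trans (inflow-≡ (fires [ i ]) h (fires-[i]-≢ (>⇒≢ grandparent<i)) refl refl)
        (trans (cong (_+ children) (*-zeroʳ (nonroot h))) one-child)
  where
  h = ⌊ i /2⌋
  children = fires [ i ] (2 * h) + fires [ i ] (2 * h + 1)
  grandparent<i : ⌊ h /2⌋ < i
  grandparent<i = ≤-<-trans (⌊n/2⌋≤n h) (⌊n/2⌋<n (suc k))
  2h≢2h+1 : 2 * h ≢ 2 * h + 1
  2h≢2h+1 = <⇒≢ (m<m+n (2 * h) (s≤s z≤n))
  one-child : children ≡ 1
  one-child with parity i
  ... | inj₁ e = cong₂ _+_ (fires-[i]-≡ e) (fires-[i]-≢ (2h≢2h+1 ∘ trans (sym e)))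
  ... | inj₂ e = cong₂ _+_ (fires-[i]-≢ (λ i≡2h → 2h≢2h+1 (trans (sym i≡2h) e))) (fires-[i]-≡ e)

unfired-balance : ∀ o L {r x d} → d ≡ 0 → r ≡ x → x + L + o * d ≡ L + r
unfired-balance o L {x = x} refl refl =
  trans (cong (x + L +_) (*-zeroʳ o)) (trans (+-identityʳ (x + L)) (+-comm x L))

fire-balance : ∀ C i a b c rest j → 1 ≤ i → 1 ≤ j → length (C i) ≡ 3 + length rest →
               length (fire C i a b c rest j) + out j * fires [ i ] j ≡ length (C j) + inflow (fires [ i ]) j
fire-balance C i a b c rest j 1≤i 1≤j |Ci| with j ≟ i
... | yes refl with j ≟ 1
...   | yes refl rewrite |Ci| = root-arith (length rest)
  where
  root-arith : ∀ L → suc (L + 2) ≡ 3 + L + 0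
  root-arith = solve-∀
...   | no j≢1
  rewrite fires-[i]-≡ (refl {x = j}) | inflow-self 1≤i | |Ci| | nonroot-≥2 (≤∧≢⇒< 1≤i (≢-sym j≢1)) =
  inner-arith (length rest)
  where
  inner-arith : ∀ L → L + 3 ≡ 3 + L + 0
  inner-arith = solve-∀
fire-balance C i a b c rest j 1≤i 1≤j |Ci| | no j≢i with j ≟ 2 * i
... | yes j≡2i = unfired-balance (out j) (length (C j)) (fires-[i]-≢ (≢-sym j≢i))
                   (inflow-child 1≤i (trans (cong ⌊_/2⌋ j≡2i) (⌊2*n/2⌋≡n i)))
... | no j≢2i with j ≟ 2 * i + 1
...   | yes j≡2i+1 = unfired-balance (out j) (length (C j)) (fires-[i]-≢ (≢-sym j≢i))
                       (inflow-child 1≤i (trans (cong ⌊_/2⌋ j≡2i+1) (⌊2*n+1/2⌋≡n i)))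
...   | no j≢2i+1 with i ≟ 1
...     | yes refl = unfired-balance (out j) (length (C j)) (fires-[i]-≢ (≢-sym j≢i))
                       (inflow-apart {1} j≢2i j≢2i+1 (>⇒≢ 1≤j))
...     | no i≢1 with j ≟ ⌊ i /2⌋
...       | yes j≡i/2 = unfired-balance (out j) (length (C j)) (fires-[i]-≢ (≢-sym j≢i))
                          (trans (cong (inflow (fires [ i ])) j≡i/2)
                                 (inflow-parent (≤∧≢⇒< 1≤i (≢-sym i≢1))))
...       | no j≢i/2 = unfired-balance (out j) (length (C j)) (fires-[i]-≢ (≢-sym j≢i))
                         (inflow-apart j≢2i j≢2i+1 j≢i/2)

run-balance : ∀ {C is C′} → Run C is C′ → ∀ j → 1 ≤ j →
              length (C′ j) + out j * fires is j ≡ length (C j) + inflow (fires is) j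
run-balance {C} done j _ =
  cong (length (C j) +_) (trans (*-zeroʳ (out j)) (sym (trans (+-identityʳ (nonroot j * 0)) (*-zeroʳ (nonroot j)))))
run-balance {C} {i ∷ is} {C′} (step i a b c rest 1≤i _ _ Ci↭ run) j 1≤j = begin
  length (C′ j) + out j * fires (i ∷ is) j
    ≡⟨ cong (λ k → length (C′ j) + out j * k) (fires-∷ i is j) ⟩
  length (C′ j) + out j * (once j + fires is j)
    ≡⟨ shuffle (length (C′ j)) (out j) (once j) (fires is j) ⟩
  (length (C′ j) + out j * fires is j) + out j * once j
    ≡⟨ cong (_+ out j * once j) (run-balance run j 1≤j) ⟩
  (length (C₁ j) + inflow (fires is) j) + out j * once j
    ≡⟨ swap (length (C₁ j)) (inflow (fires is) j) (out j * once j) ⟩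
  (length (C₁ j) + out j * once j) + inflow (fires is) j
    ≡⟨ cong (_+ inflow (fires is) j) (fire-balance C i a b c rest j 1≤i 1≤j (↭-length Ci↭)) ⟩
  (length (C j) + inflow once j) + inflow (fires is) j
    ≡⟨ +-assoc (length (C j)) (inflow once j) (inflow (fires is) j) ⟩
  length (C j) + (inflow once j + inflow (fires is) j)
    ≡⟨ cong (length (C j) +_) (sym (inflow-+ {once} {fires is} j (fires-∷ i is))) ⟩
  length (C j) + inflow (fires (i ∷ is)) j ∎
  where
  open ≡-Reasoning
  once = fires [ i ]
  C₁ = fire C i a b c rest
  shuffle : ∀ L o x y → L + o * (x + y) ≡ (L + o * y) + o * x
  shuffle = solve-∀
  swap : ∀ x y z → (x + y) + z ≡ (x + z) + y
  swap = solve-∀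

-- Firing whole levels

-- In the level-symmetric process all nodes of a level fire together, so a state is an odometer
-- counting the firings of each level; Holds a ℓ y says that every node of level ℓ then holds at
-- least y chips (K chips start at the root), stated without truncated subtraction.
module LevelDynamics (K : ℕ) where

  Odometer : Set
  Odometer = ℕ → ℕ

  levelInflow : Odometer → ℕ → ℕ
  levelInflow a ℓ = nonroot ℓ * a (pred ℓ) + 2 * a (suc ℓ)

  record Holds (a : Odometer) (ℓ y : ℕ) : Set where
    constructor holds
    field
      bound : y + out ℓ * a ℓ ≤ atRoot K ℓ + levelInflow a ℓ

  fireLevel : ℕ → Odometer → Odometer
  fireLevel ℓ a i = fires [ ℓ ] i + a i

  data Step : Odometer → Odometer → Set where
    fire-level : ∀ {a} ℓ → 1 ≤ ℓ → Holds a ℓ 3 → Step a (fireLevel ℓ a)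

  Reachable : Odometer → Odometer → Set
  Reachable = Star Step

  fireLevel-self : ∀ ℓ a → fireLevel ℓ a ℓ ≡ suc (a ℓ)
  fireLevel-self ℓ a = cong (_+ a ℓ) (fires-[i]-≡ {ℓ} refl)

  fireLevel-other : ∀ {ℓ i} a → i ≢ ℓ → fireLevel ℓ a i ≡ a i
  fireLevel-other a i≢ℓ = cong (_+ a _) (fires-[i]-≢ (≢-sym i≢ℓ))

  fireLevel-mono : ∀ ℓ a i → a i ≤ fireLevel ℓ a i
  fireLevel-mono ℓ a i = m≤n+m (a i) (fires [ ℓ ] i)

  levelInflow-grows : ∀ {a b ℓ} s t → 1 ≤ ℓ →
                      (2 ≤ ℓ → s + a (pred ℓ) ≤ b (pred ℓ)) → t + a (suc ℓ) ≤ b (suc ℓ) →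
                      nonroot ℓ * s + 2 * t + levelInflow a ℓ ≤ levelInflow b ℓ
  levelInflow-grows {a} {b} {suc zero} s t _ _ child = begin
    2 * t + 2 * a 2   ≡⟨ sym (*-distribˡ-+ 2 t (a 2)) ⟩
    2 * (t + a 2)     ≤⟨ *-monoʳ-≤ 2 child ⟩
    2 * b 2           ∎
    where open ≤-Reasoning
  levelInflow-grows {a} {b} {suc (suc k)} s t _ parent child = begin
    1 * s + 2 * t + (1 * a (1 + k) + 2 * a (3 + k))   ≡⟨ regroup s t (a (1 + k)) (a (3 + k)) ⟩
    1 * (s + a (1 + k)) + 2 * (t + a (3 + k))         ≤⟨ +-mono-≤ (*-monoʳ-≤ 1 (parent (s≤s (s≤s z≤n))))
                                                                  (*-monoʳ-≤ 2 child) ⟩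
    1 * b (1 + k) + 2 * b (3 + k)                     ∎
    where
    open ≤-Reasoning
    regroup : ∀ s t x y → 1 * s + 2 * t + (1 * x + 2 * y) ≡ 1 * (s + x) + 2 * (t + y)
    regroup = solve-∀

  Holds-transfer : ∀ {a b ℓ y y′} d s t → 1 ≤ ℓ → Holds a ℓ y → b ℓ ≡ d + a ℓ →
                   (2 ≤ ℓ → s + a (pred ℓ) ≤ b (pred ℓ)) → t + a (suc ℓ) ≤ b (suc ℓ) →
                   y′ + out ℓ * d ≤ y + (nonroot ℓ * s + 2 * t) → Holds b ℓ y′
  Holds-transfer {a} {b} {ℓ} {y} {y′} d s t 1≤ℓ (holds bound) bℓ parent child budget = holds $ begin
    y′ + out ℓ * b ℓ
      ≡⟨ cong (λ x → y′ + out ℓ * x) bℓ ⟩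
    y′ + out ℓ * (d + a ℓ)
      ≡⟨ split y′ (out ℓ) d (a ℓ) ⟩
    (y′ + out ℓ * d) + out ℓ * a ℓ
      ≤⟨ +-monoˡ-≤ (out ℓ * a ℓ) budget ⟩
    (y + gain) + out ℓ * a ℓ
      ≡⟨ swap y gain (out ℓ * a ℓ) ⟩
    (y + out ℓ * a ℓ) + gain
      ≤⟨ +-monoˡ-≤ gain bound ⟩
    (atRoot K ℓ + levelInflow a ℓ) + gain
      ≡⟨ +-assoc (atRoot K ℓ) (levelInflow a ℓ) gain ⟩
    atRoot K ℓ + (levelInflow a ℓ + gain)
      ≡⟨ cong (atRoot K ℓ +_) (+-comm (levelInflow a ℓ) gain) ⟩
    atRoot K ℓ + (gain + levelInflow a ℓ)
      ≤⟨ +-monoʳ-≤ (atRoot K ℓ) (levelInflow-grows {a} {b} s t 1≤ℓ parent child) ⟩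
    atRoot K ℓ + levelInflow b ℓ ∎
    where
    open ≤-Reasoning
    gain = nonroot ℓ * s + 2 * t
    split : ∀ y o d x → y + o * (d + x) ≡ (y + o * d) + o * x
    split = solve-∀
    swap : ∀ x y z → (x + y) + z ≡ (x + z) + y
    swap = solve-∀

  Holds-weaken : ∀ {a ℓ y y′} → y′ ≤ y → Holds a ℓ y → Holds a ℓ y′
  Holds-weaken {a} {ℓ} y′≤y (holds bound) = holds (≤-trans (+-monoˡ-≤ (out ℓ * a ℓ) y′≤y) bound)

  Holds-mono : ∀ {a b ℓ y} → 1 ≤ ℓ → (∀ i → a i ≤ b i) → b ℓ ≡ a ℓ → Holds a ℓ y → Holds b ℓ y
  Holds-mono {ℓ = ℓ} {y} 1≤ℓ a≤b bℓ h =
    Holds-transfer 0 0 0 1≤ℓ h bℓ (λ _ → a≤b (pred ℓ)) (a≤b (suc ℓ))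
      (≤-reflexive (no-gain y (out ℓ) (nonroot ℓ)))
    where
    no-gain : ∀ y o r → y + o * 0 ≡ y + (r * 0 + 2 * 0)
    no-gain = solve-∀

  Filled : ℕ → Odometer → Set
  Filled p a = ∀ i → 1 ≤ i → i < p → Holds a i 1

  Filled-extend : ∀ {p a} → Filled p a → Holds a p 1 → Filled (suc p) a
  Filled-extend filled top i 1≤i i<1+p with m≤n⇒m<n∨m≡n (s≤s⁻¹ i<1+p)
  ... | inj₁ i<p  = filled i 1≤i i<p
  ... | inj₂ refl = top

  sweep : ℕ → Odometer → Odometer
  sweep zero    a = a
  sweep (suc p) a = sweep p (fireLevel (suc p) a)

  sweep-fixes : ∀ p a i → p < i → sweep p a i ≡ a i
  sweep-fixes zero    a i _   = refl
  sweep-fixes (suc p) a i p<i =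
    trans (sweep-fixes p (fireLevel (suc p) a) i (<-trans (n<1+n p) p<i)) (fireLevel-other a (>⇒≢ p<i))

  sweep-raises : ∀ p a i → 1 ≤ i → i ≤ p → sweep p a i ≡ suc (a i)
  sweep-raises zero    a i 1≤i i≤0 = ⊥-elim (<⇒≱ 1≤i i≤0)
  sweep-raises (suc p) a i 1≤i i≤1+p with m≤n⇒m<n∨m≡n i≤1+p
  ... | inj₁ i<1+p = trans (sweep-raises p (fireLevel (suc p) a) i 1≤i (s≤s⁻¹ i<1+p))
                           (cong suc (fireLevel-other a (<⇒≢ i<1+p)))
  ... | inj₂ refl  = trans (sweep-fixes p (fireLevel (suc p) a) i (n<1+n p)) (fireLevel-self i a)

  sweep-reachable : ∀ p {a} → 1 ≤ p → Filled p a → Holds a p 3 → Reachable a (sweep p a)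
  sweep-reachable (suc zero)    _ _      top = fire-level 1 (s≤s z≤n) top ◅ ε
  sweep-reachable (suc (suc q)) {a} _ filled top =
    fire-level (2 + q) (s≤s z≤n) top ◅ sweep-reachable (suc q) (s≤s z≤n) filled′ top′
    where
    a′ = fireLevel (2 + q) a
    child-gain : ∀ o r → 3 + o * 0 ≡ 1 + (r * 0 + 2 * 1)
    child-gain = solve-∀
    top′ : Holds a′ (suc q) 3
    top′ = Holds-transfer 0 0 1 (s≤s z≤n) (filled (suc q) (s≤s z≤n) ≤-refl)
             (fireLevel-other a (<⇒≢ ≤-refl)) (λ _ → fireLevel-mono (2 + q) a q)
             (≤-reflexive (sym (fireLevel-self (2 + q) a))) (≤-reflexive (child-gain (out (suc q)) (nonroot (suc q))))
    filled′ : Filled (suc q) a′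
    filled′ i 1≤i i<1+q = Holds-mono 1≤i (fireLevel-mono (2 + q) a) (fireLevel-other a (<⇒≢ i<2+q))
                            (filled i 1≤i i<2+q)
      where
      i<2+q : i < 2 + q
      i<2+q = <-trans i<1+q ≤-refl

  sweep-filled : ∀ p {a} → Filled p a → Filled p (sweep p a)
  sweep-filled p {a} filled i 1≤i i<p =
    Holds-transfer 1 1 1 1≤i (filled i 1≤i i<p) (sweep-raises p a i 1≤i (<⇒≤ i<p))
      (λ 2≤i → ≤-reflexive (sym (sweep-raises p a (pred i) (pred-mono-≤ 2≤i) (≤-trans pred[n]≤n (<⇒≤ i<p)))))
      (≤-reflexive (sym (sweep-raises p a (suc i) (s≤s z≤n) i<p)))
      (≤-reflexive (all-raised 1 (nonroot i)))
    where
    all-raised : ∀ y r → y + (2 + r) * 1 ≡ y + (r * 1 + 2 * 1)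
    all-raised = solve-∀

  sweep-top : ∀ p {a y} → 1 ≤ p → Holds a p (2 + y) → Holds (sweep p a) p y
  sweep-top p {a} {y} 1≤p top =
    Holds-transfer 1 1 0 1≤p top (sweep-raises p a p 1≤p ≤-refl)
      (λ 2≤p → ≤-reflexive (sym (sweep-raises p a (pred p) (pred-mono-≤ 2≤p) pred[n]≤n)))
      (≤-reflexive (sym (sweep-fixes p a (suc p) ≤-refl)))
      (≤-reflexive (parent-raised y (nonroot p)))
    where
    parent-raised : ∀ y r → y + (2 + r) * 1 ≡ 2 + y + (r * 1 + 2 * 0)
    parent-raised = solve-∀

  sweep-next : ∀ p {a y} → 1 ≤ p → Holds a (suc p) y → Holds (sweep p a) (suc p) (suc y)
  sweep-next p@(suc _) {a} {y} 1≤p next =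
    Holds-transfer 0 1 0 (s≤s z≤n) next (sweep-fixes p a (suc p) ≤-refl)
      (λ _ → ≤-reflexive (sym (sweep-raises p a p 1≤p ≤-refl)))
      (≤-reflexive (sym (sweep-fixes p a (2 + p) (n≤1+n (suc p)))))
      (≤-reflexive (parent-raised y (out (suc p))))
    where
    parent-raised : ∀ y o → suc y + o * 0 ≡ y + (1 * 1 + 2 * 0)
    parent-raised = solve-∀

  record PhaseOutcome (p k y : ℕ) (a : Odometer) : Set where
    field
      result : Odometer
      reach  : Reachable a result
      filled : Filled (suc p) result
      next   : Holds result (suc p) (k + y)
      raised : ∀ i → 1 ≤ i → i ≤ p → k + a i ≤ result i
      fixed  : ∀ i → p < i → result i ≡ a i

  phase : ∀ k {p y a} → 1 ≤ p → Filled p a → Holds a p (2 * k + 1) → Holds a (suc p) y → PhaseOutcome p k y a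
  phase zero {a = a} _ filled top next = record
    { result = a
    ; reach  = ε
    ; filled = Filled-extend filled top
    ; next   = next
    ; raised = λ _ _ _ → ≤-refl
    ; fixed  = λ _ _ → refl
    }
  phase (suc k) {p} {y} {a} 1≤p filled top next = record
    { result = P.result
    ; reach  = sweep-reachable p 1≤p filled (Holds-weaken (s≤s (s≤s (m≤n+m 1 (2 * k)))) top′) ◅◅ P.reach
    ; filled = P.filled
    ; next   = subst (Holds P.result (suc p)) (+-suc k y) P.next
    ; raised = λ i 1≤i i≤p → subst (_≤ P.result i)
                                    (trans (cong (k +_) (sweep-raises p a i 1≤i i≤p)) (+-suc k (a i)))
                                    (P.raised i 1≤i i≤p)
    ; fixed  = λ i p<i → trans (P.fixed i p<i) (sweep-fixes p a i p<i)
    }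
    where
    top′ : Holds a p (2 + (2 * k + 1))
    top′ = subst (Holds a p) (cong (_+ 1) (*-suc 2 k)) top
    P = phase k 1≤p (sweep-filled p filled) (sweep-top p 1≤p top′) (sweep-next p 1≤p next)
    module P = PhaseOutcome P

  QuietBeyond : ℕ → Odometer → Set
  QuietBeyond p a = ∀ i → p < i → a i ≡ 0

  Holds-quiet : ∀ {p a ℓ} → QuietBeyond p a → p < ℓ → Holds a ℓ 0
  Holds-quiet {ℓ = ℓ} quiet p<ℓ =
    holds (≤-trans (≤-reflexive (trans (cong (out ℓ *_) (quiet ℓ p<ℓ)) (*-zeroʳ (out ℓ)))) z≤n)

  Deep : ℕ → Odometer → Set
  Deep p a = ∀ i → 1 ≤ i → p ≤ a i + i

  phases : ∀ m {p a} → 1 ≤ p → Filled p a → Holds a p (mersenne (suc m)) → QuietBeyond p a → Deep p a →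
           Σ Odometer λ a′ → Reachable a a′ × Deep (p + m) a′
  phases zero {p} {a} _ _ _ _ deep = a , ε , λ i 1≤i → subst (_≤ a i + i) (sym (+-identityʳ p)) (deep i 1≤i)
  phases (suc m) {p} {a} 1≤p filled top quiet deep =
    let a′ , reach , deep″ = phases m (s≤s z≤n) P.filled next quiet′ deep′
    in  a′ , P.reach ◅◅ reach , subst (λ q → Deep q a′) (sym (+-suc p m)) deep″
    where
    k = mersenne (suc m)
    P = phase k 1≤p filled top (Holds-quiet quiet ≤-refl)
    module P = PhaseOutcome P
    next : Holds P.result (suc p) (mersenne (suc m))
    next = subst (Holds P.result (suc p)) (+-identityʳ k) P.next
    quiet′ : QuietBeyond (suc p) P.result
    quiet′ i 1+p<i = trans (P.fixed i (<-trans (n<1+n p) 1+p<i)) (quiet i (<-trans (n<1+n p) 1+p<i))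
    deep′ : Deep (suc p) P.result
    deep′ i 1≤i with i ≤? p
    ... | yes i≤p = ≤-trans (s≤s (deep i 1≤i))
                      (+-monoˡ-≤ i (≤-trans (+-monoˡ-≤ (a i) (m≤n+m 1 _)) (P.raised i 1≤i i≤p)))
    ... | no  i≰p = ≤-trans (≰⇒> i≰p) (m≤n+m i (P.result i))

  deep-odometer : ∀ n → mersenne n ≤ K → Σ Odometer λ a → Reachable (λ _ → 0) a × Deep n a
  deep-odometer zero    _      = (λ _ → 0) , ε , λ _ _ → z≤n
  deep-odometer (suc m) enough =
    phases m (s≤s z≤n) (λ i 1≤i i<1 → ⊥-elim (<⇒≱ i<1 1≤i)) (holds (+-monoˡ-≤ 0 enough))
      (λ _ _ → refl) (λ _ 1≤i → 1≤i)

-- Least action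

module LeastAction (K : ℕ) (f final : ℕ → ℕ) (final<3 : ∀ j → final j < 3)
                   (balance : ∀ j → 1 ≤ j → final j + out j * f j ≡ atRoot K j + inflow f j) where

  open LevelDynamics K

  Dominated : Odometer → Set
  Dominated a = ∀ w → 1 ≤ w → a (level w) ≤ f w

  levelInflow-dominated : ∀ {a} → Dominated a → ∀ w → 1 ≤ w → levelInflow a (level w) ≤ inflow f w
  levelInflow-dominated {a} dom w 1≤w = +-mono-≤ (from-parent w 1≤w) from-children
    where
    from-parent : ∀ w → 1 ≤ w → nonroot (level w) * a (pred (level w)) ≤ nonroot w * f ⌊ w /2⌋
    from-parent (suc zero)      _ = z≤n
    from-parent w@(suc (suc _)) _ = begin
      nonroot (level w) * a (pred (level w))  ≡⟨ cong₂ _*_ (nonroot-level w (s≤s z≤n))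
                                                           (cong (a ∘ pred) (level-parent w (s≤s (s≤s z≤n)))) ⟩
      1 * a (level ⌊ w /2⌋)                   ≤⟨ *-monoʳ-≤ 1 (dom ⌊ w /2⌋ (s≤s z≤n)) ⟩
      1 * f ⌊ w /2⌋                           ∎
      where open ≤-Reasoning
    from-children : 2 * a (suc (level w)) ≤ f (2 * w) + f (2 * w + 1)
    from-children = begin
      2 * a (suc (level w))                   ≡⟨ cong (a (suc (level w)) +_) (+-identityʳ _) ⟩
      a (suc (level w)) + a (suc (level w))   ≤⟨ +-mono-≤ left right ⟩
      f (2 * w) + f (2 * w + 1)               ∎
      where
      open ≤-Reasoning
      left : a (suc (level w)) ≤ f (2 * w)
      left = subst (λ ℓ → a ℓ ≤ f (2 * w)) (level-double w 1≤w) (dom (2 * w) (≤-trans 1≤w (m≤n*m w 2)))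
      right : a (suc (level w)) ≤ f (2 * w + 1)
      right = subst (λ ℓ → a ℓ ≤ f (2 * w + 1)) (level-double+1 w 1≤w) (dom (2 * w + 1) (m≤n+m 1 (2 * w)))

  -- If level ℓ had fired exactly as often as its node w, the legal firing of ℓ would show that w
  -- still holds three chips at the end.
  dominated-step : ∀ {a b} → Dominated a → Step a b → Dominated b
  dominated-step {a} dom (fire-level ℓ _ (holds three)) w 1≤w with level w ≟ ℓ
  ... | no  ℓw≢ℓ = subst (_≤ f w) (sym (fireLevel-other a ℓw≢ℓ)) (dom w 1≤w)
  ... | yes refl = subst (_≤ f w) (sym (fireLevel-self (level w) a)) unsaturated
    where
    open ≤-Reasoning
    overflow : a (level w) ≡ f w → 3 ≤ final w
    overflow saturated = +-cancelʳ-≤ (out w * f w) 3 (final w) $ begin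
      3 + out w * f w
        ≡⟨ cong₂ (λ o x → 3 + o * x) (cong (2 +_) (sym (nonroot-level w 1≤w))) (sym saturated) ⟩
      3 + out (level w) * a (level w)
        ≤⟨ three ⟩
      atRoot K (level w) + levelInflow a (level w)
        ≤⟨ +-mono-≤ (≤-reflexive (atRoot-level K w 1≤w)) (levelInflow-dominated {a} dom w 1≤w) ⟩
      atRoot K w + inflow f w
        ≡⟨ sym (balance w 1≤w) ⟩
      final w + out w * f w ∎
    unsaturated : a (level w) < f w
    unsaturated with m≤n⇒m<n∨m≡n (dom w 1≤w)
    ... | inj₁ lt        = lt
    ... | inj₂ saturated = ⊥-elim (<⇒≱ (final<3 w) (overflow saturated))

  dominated-reachable : ∀ {a b} → Dominated a → Reachable a b → Dominated b
  dominated-reachable dom ε          = dom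
  dominated-reachable dom (s ◅ rest) = dominated-reachable (dominated-step dom s) rest

fires-lower-bound : ∀ {n is C} → Run (initial n) is C → Terminal C →
                    ∀ w → 1 ≤ w → n ≤ fires is w + level w
fires-lower-bound {n} {is} {C} run terminal w 1≤w =
  let a , reach , deep = deep-odometer n (≤-reflexive (mersenne≡2^n∸1 n))
  in  ≤-trans (deep (level w) (1≤level w))
              (+-monoˡ-≤ (level w) (dominated-reachable (λ _ _ → z≤n) reach w 1≤w))
  where
  open LevelDynamics (2 ^ n ∸ 1)
  open LeastAction (2 ^ n ∸ 1) (fires is) (length ∘ C) terminal
         (λ j 1≤j → trans (run-balance run j 1≤j) (cong (_+ inflow (fires is) j) (initial-length n j)))

-- Counting the endgame moves

≤-pair-irrelevant : ∀ {a b c d} (p q : a ≤ b × c ≤ d) → p ≡ q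
≤-pair-irrelevant (p₁ , p₂) (q₁ , q₂) = cong₂ _,_ (≤-irrelevant p₁ q₁) (≤-irrelevant p₂ q₂)

Σ-≡-irrelevant : ∀ {A : Set} {B : A → Set} → (∀ {x} (p q : B x) → p ≡ q) →
                 ∀ {x y} {p : B x} {q : B y} → x ≡ y → _≡_ {A = Σ A B} (x , p) (y , q)
Σ-≡-irrelevant irrelevant refl = cong (_ ,_) (irrelevant _ _)

Slot : ℕ → ℕ × ℕ → Set
Slot n (i , j) = 1 ≤ i × level i + j < n

endgame↔slots : ∀ n is → (∀ w → 1 ≤ w → n ≤ fires is w + level w) →
                Σ (ℕ × ℕ) (EndgameMove n is) ↔ Σ (ℕ × ℕ) (Slot n)
endgame↔slots n is bound = mk↔ₛ′ to from (λ _ → refl) from∘to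
  where
  to : Σ (ℕ × ℕ) (EndgameMove n is) → Σ (ℕ × ℕ) (Slot n)
  to ((i , j) , 1≤i , _ , shallow) = (i , j) , 1≤i , shallow
  fired : ∀ i j → 1 ≤ i → level i + j < n → j < fires is i
  fired i j 1≤i shallow =
    +-cancelʳ-< (level i) j (fires is i) (<-≤-trans (subst (_< n) (+-comm (level i) j) shallow) (bound i 1≤i))
  from : Σ (ℕ × ℕ) (Slot n) → Σ (ℕ × ℕ) (EndgameMove n is)
  from ((i , j) , 1≤i , shallow) = (i , j) , 1≤i , fired i j 1≤i shallow , shallow
  from∘to : ∀ m → from (to m) ≡ m
  from∘to ((i , j) , 1≤i , _ , shallow) = cong (λ p → (i , j) , 1≤i , p , shallow) (<-irrelevant _ _)

nodes↔Fin : ∀ n → Σ ℕ (λ v → 1 ≤ v × level v ≤ n) ↔ Fin (mersenne n)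
nodes↔Fin n = mk↔ₛ′ to from (λ k → fromℕ<-toℕ k _) from∘to
  where
  to : Σ ℕ (λ v → 1 ≤ v × level v ≤ n) → Fin (mersenne n)
  to (suc v , 1≤v , lv≤n) = fromℕ< (level≤⇒≤mersenne n (suc v) 1≤v lv≤n)
  from : Fin (mersenne n) → Σ ℕ (λ v → 1 ≤ v × level v ≤ n)
  from k = suc (toℕ k) , s≤s z≤n , ≤mersenne⇒level≤ n (suc (toℕ k)) (s≤s z≤n) (toℕ<n k)
  from∘to : ∀ x → from (to x) ≡ x
  from∘to (suc v , _) = Σ-≡-irrelevant ≤-pair-irrelevant (cong suc (toℕ-fromℕ< _))

slots-zero : Σ (ℕ × ℕ) (Slot 0) ↔ Fin 0
slots-zero = mk↔ₛ′ (λ { (_ , _ , ()) }) (λ ()) (λ ()) (λ { (_ , _ , ()) })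

slots-suc : ∀ n → Σ (ℕ × ℕ) (Slot (suc n)) ↔
                  (Σ ℕ (λ v → 1 ≤ v × level v ≤ n) ⊎ Σ (ℕ × ℕ) (Slot n))
slots-suc n = mk↔ₛ′ to from to∘from from∘to
  where
  to : Σ (ℕ × ℕ) (Slot (suc n)) → Σ ℕ (λ v → 1 ≤ v × level v ≤ n) ⊎ Σ (ℕ × ℕ) (Slot n)
  to ((i , zero)  , 1≤i , lt) = inj₁ (i , 1≤i , s≤s⁻¹ (subst (_< suc n) (+-identityʳ (level i)) lt))
  to ((i , suc j) , 1≤i , lt) = inj₂ ((i , j) , 1≤i , s≤s⁻¹ (subst (_< suc n) (+-suc (level i) j) lt))
  from : Σ ℕ (λ v → 1 ≤ v × level v ≤ n) ⊎ Σ (ℕ × ℕ) (Slot n) → Σ (ℕ × ℕ) (Slot (suc n))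
  from (inj₁ (i , 1≤i , le))       = (i , 0) , 1≤i , subst (_< suc n) (sym (+-identityʳ (level i))) (s≤s le)
  from (inj₂ ((i , j) , 1≤i , lt)) = (i , suc j) , 1≤i , subst (_< suc n) (sym (+-suc (level i) j)) (s≤s lt)
  to∘from : ∀ x → to (from x) ≡ x
  to∘from (inj₁ _) = cong inj₁ (Σ-≡-irrelevant ≤-pair-irrelevant refl)
  to∘from (inj₂ _) = cong inj₂ (Σ-≡-irrelevant ≤-pair-irrelevant refl)
  from∘to : ∀ x → from (to x) ≡ x
  from∘to ((_ , zero)  , _) = Σ-≡-irrelevant ≤-pair-irrelevant refl
  from∘to ((_ , suc _) , _) = Σ-≡-irrelevant ≤-pair-irrelevant refl

slots↔Fin : ∀ n → Σ (ℕ × ℕ) (Slot n) ↔ Fin (mersenne n ∸ n)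
slots↔Fin zero    = slots-zero
slots↔Fin (suc n) = subst (λ k → Σ (ℕ × ℕ) (Slot (suc n)) ↔ Fin k) count
  (↔-trans (slots-suc n) (↔-trans (nodes↔Fin n ⊎-↔ slots↔Fin n) (↔-sym +↔⊎)))
  where
  open ≡-Reasoning
  M = mersenne n
  count : M + (M ∸ n) ≡ 2 * M + 1 ∸ suc n
  count = begin
    M + (M ∸ n)         ≡⟨ sym (+-∸-assoc M (n≤mersenne n)) ⟩
    M + M ∸ n           ≡⟨ cong (λ x → M + x ∸ n) (sym (+-identityʳ M)) ⟩
    2 * M ∸ n           ≡⟨ cong (_∸ suc n) (+-comm 1 (2 * M)) ⟩
    2 * M + 1 ∸ suc n   ∎

corollary6p5 : (n : ℕ) → 0 < n → (is : List ℕ) → Complete n is →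
    Σ (ℕ × ℕ) (EndgameMove n is) ↔ Fin (2 ^ n ∸ (n + 1))
corollary6p5 n _ is (C , run , terminal) =
  subst (λ k → Σ (ℕ × ℕ) (EndgameMove n is) ↔ Fin k) (sym size)
    (↔-trans (endgame↔slots n is (fires-lower-bound run terminal)) (slots↔Fin n))
  where
  open ≡-Reasoning
  size : 2 ^ n ∸ (n + 1) ≡ mersenne n ∸ n
  size = begin
    2 ^ n ∸ (n + 1)   ≡⟨ cong (2 ^ n ∸_) (+-comm n 1) ⟩
    2 ^ n ∸ (1 + n)   ≡⟨ sym (∸-+-assoc (2 ^ n) 1 n) ⟩
    2 ^ n ∸ 1 ∸ n     ≡⟨ cong (_∸ n) (sym (mersenne≡2^n∸1 n)) ⟩
    mersenne n ∸ n    ∎
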